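{- The $\mathcal{SDD}_c$ size of $F_n$ is $O(n^3)$.
   Context: For $i\in\{0,\dots,n\}$, $E^i_n(x_1,\dots,x_n)$ is the boolean function that is true exactly when $x_1+\cdots+x_n=i$. Define $P_0\equiv E^0_n$, $P_n\equiv E^n_n$, and for $i=1,\dots,n-1$: $P_{i,0}\equiv E^i_n\wedge\neg x_i$, $P_{i,1}\equiv E^i_n\wedge x_i$. With fresh variables $y_0,\dots,y_n$, the generalized hidden weighted bit function $F_n(x_1,\dots,x_n,y_0,\dots,y_n)$ is $(P_0\wedge\neg y_0)\vee(P_n\wedge y_n)\vee\bigvee_{i=1}^{n-1}\big((P_{i,0}\wedge\neg y_i)\vee(P_{i,1}\wedge y_i)\big)$. Circuits are NNFs: boolean circuits (DAGs with one output gate) whose input gates are labelled by constants $\bot,\top$ or literals, and internal gates are unbounded-fanin $\vee$, $\wedge$. Size = number of arcs. $C_g$ is the subcircuit with output $g$. For a class $\mathcal{L}$, the $\mathcal{L}$ size of $f$ is the minimum size of a circuit in $\mathcal{L}$ computing $f$. A vtree for a finite nonempty set $Y$ is a rooted, full, ordered binary tree with leaves identified bijectively with $Y$; for internal $v$, $v_l,v_r$ are its children, $T_v$ its subtree, $Y_v$ its leaf set. An SDD respecting vtree $T$ is defined inductively: (i) a single literal gate on a variable that is a leaf of $T$; (ii) a single constant gate; (iii) $C=\bigvee_{i=1}^m (C_{p_i}\wedge C_{s_i})$, $m\ge2$, such that for some internal node $v$ of $T$ and all $i$: $C_{p_i}$ is an SDD respecting a subtree of $T_{v_l}$, $C_{s_i}$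 an SDD respecting a subtree of $T_{v_r}$, and as functions on $Y_{v_l}$: $C_{p_i}\not\equiv\bot$, $C_{p_i}\wedge C_{p_j}\equiv\bot$ ($i<j$), $\bigvee_iC_{p_i}\equiv\top$. An SDD is compressed if at every $\vee$-gate of form (iii) relative to node $v$, $C_{s_i}\not\equiv C_{s_j}$ for $i<j$ as functions on $Y_{v_r}$. $\mathcal{SDD}_c$ is the class of compressed SDDs (respecting some vtree). -}

module Defs where

open import Data.Nat using (ℕ; zero; suc; _+_; _*_; _^_; _≤_; _<ᵇ_; _≡ᵇ_)
open import Data.Fin using (Fin; zero; suc; toℕ; fromℕ)
open import Data.Bool using (Bool; true; false; _∧_; _∨_; not; if_then_else_)
open import Data.List using (List; []; _∷_; length; map; allFin)
open import Data.Nat.ListAction using (sum)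
open import Data.Bool.ListAction using (any)
import Data.Bool.ListAction as BL
import Data.List as L
open import Data.List.Membership.Propositional using (_∈_)
open import Data.List.Relation.Unary.Unique.Propositional using (Unique)
open import Data.List.Relation.Unary.AllPairs using (AllPairs)
open import Data.List.Relation.Unary.All using (All)
open import Data.List.Relation.Binary.Pointwise using (Pointwise)
open import Data.Sum using (_⊎_; inj₁; inj₂)
open import Data.Product using (Σ; ∃; _×_; _,_; proj₁; proj₂)
open import Relation.Binary.PropositionalEquality using (_≡_; _≢_)

-- Variables of F_n:  inj₁ j  is  x_{j+1}  (j : Fin n),
--                    inj₂ i  is  y_i      (i : Fin (n+1)).

Var : ℕ → Set
Var n = Fin n ⊎ Fin (suc n)

x : ∀ {n} → Fin n → Var n
x = inj₁

y : ∀ {n} → Fin (suc n) → Var n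
y = inj₂

weight : (n : ℕ) → (Var n → Bool) → ℕ
weight n ρ = sum (map (λ j → if ρ (x j) then 1 else 0) (allFin n))

E : (n i : ℕ) → (Var n → Bool) → Bool
E n i ρ = weight n ρ ≡ᵇ i

-- The generalized hidden weighted bit function F_n.
-- The index i ∈ {1,…,n-1} is written i = toℕ j + 1 with j : Fin n and
-- the side condition toℕ j + 1 < n;  x_i = x j,  y_i = y (suc j).
F : (n : ℕ) → (Var n → Bool) → Bool
F n ρ =
  (P0 ∧ not (ρ (y zero))) ∨ (Pn ∧ ρ (y (fromℕ n))) ∨
  any (λ j → (suc (toℕ j) <ᵇ n) ∧
             (((E n (suc (toℕ j)) ρ ∧ not (ρ (x j))) ∧ not (ρ (y (suc j)))) ∨
              ((E n (suc (toℕ j)) ρ ∧ ρ (x j)) ∧ ρ (y (suc j)))))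
      (allFin n)
  where
  P0 = E n 0 ρ
  Pn = E n n ρ

-- NNF circuits, represented as DAGs listed in topological order.
-- A circuit with k gates is a snoc-list; the newest gate has index zero
-- and each gate's children are (indices of) strictly older gates.

data Gate (V : Set) (k : ℕ) : Set where
  const : Bool → Gate V k
  lit   : V → Bool → Gate V k
  or    : List (Fin k) → Gate V k
  and   : List (Fin k) → Gate V k

data Circ (V : Set) : ℕ → Set where
  []  : Circ V 0
  _▷_ : ∀ {k} → Circ V k → Gate V k → Circ V (suc k)

mapGate : ∀ {V k l} → (Fin k → Fin l) → Gate V k → Gate V l
mapGate f (const b) = const b
mapGate f (lit v b) = lit v b
mapGate f (or cs)   = or (map f cs)
mapGate f (and cs)  = and (map f cs)

-- the gate at a given index, with children as indices of the whole circuit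
gateAt : ∀ {V k} → Circ V k → Fin k → Gate V k
gateAt (C ▷ g) zero    = mapGate suc g
gateAt (C ▷ g) (suc i) = mapGate suc (gateAt C i)

evalGate : ∀ {V k} → Gate V k → (Fin k → Bool) → (V → Bool) → Bool
evalGate (const b) val ρ = b
evalGate (lit v b) val ρ = if b then ρ v else not (ρ v)
evalGate (or cs)   val ρ = BL.or (map val cs)
evalGate (and cs)  val ρ = BL.and (map val cs)

evalAll : ∀ {V k} → Circ V k → (V → Bool) → Fin k → Bool
evalAll (C ▷ g) ρ zero    = evalGate g (evalAll C ρ) ρ
evalAll (C ▷ g) ρ (suc i) = evalAll C ρ i

⟦_⟧ : ∀ {V k} → Circ V k → Fin k → (V → Bool) → Bool
⟦ C ⟧ g ρ = evalAll C ρ g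

fanin : ∀ {V k} → Gate V k → ℕ
fanin (const _) = 0
fanin (lit _ _) = 0
fanin (or cs)   = length cs
fanin (and cs)  = length cs

size : ∀ {V k} → Circ V k → ℕ
size []      = 0
size (C ▷ g) = size C + fanin g

data VTree (V : Set) : Set where
  leaf : V → VTree V
  node : VTree V → VTree V → VTree V

leaves : ∀ {V} → VTree V → List V
leaves (leaf v)   = v ∷ []
leaves (node l r) = leaves l L.++ leaves r

IsVtreeFor : (V : Set) → VTree V → Set
IsVtreeFor V T = Unique (leaves T) × (∀ (v : V) → v ∈ leaves T)

data _⊑_ {V : Set} : VTree V → VTree V → Set where
  here : ∀ {T} → T ⊑ T
  inl  : ∀ {S l r} → S ⊑ l → S ⊑ node l r
  inr  : ∀ {S l r} → S ⊑ r → S ⊑ node l r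

-- Compressed SDDs.  SDDc C g T : the subcircuit C_g is a compressed SDD
-- respecting vtree T.  Semantic conditions are evaluated on full
-- assignments ρ : V → Bool.

data SDDc {V : Set} {k : ℕ} (C : Circ V k) : Fin k → VTree V → Set where
  sdd-lit   : ∀ {g T v b} → gateAt C g ≡ lit v b → leaf v ⊑ T → SDDc C g T
  sdd-const : ∀ {g T b} → gateAt C g ≡ const b → SDDc C g T
  sdd-dec   : ∀ {g T l r}
    → node l r ⊑ T
    → (as : List (Fin k))
    → (ps : List (Fin k × Fin k))
    → gateAt C g ≡ or as
    → 2 ≤ length as
    → Pointwise (λ a ps → gateAt C a ≡ and (proj₁ ps ∷ proj₂ ps ∷ [])) as ps
    → All (λ ps → Σ (VTree V) λ Tp → Tp ⊑ l × SDDc C (proj₁ ps) Tp) ps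
    → All (λ ps → Σ (VTree V) λ Ts → Ts ⊑ r × SDDc C (proj₂ ps) Ts) ps
    → All (λ ps → ∃ λ ρ → ⟦ C ⟧ (proj₁ ps) ρ ≡ true) ps
    → AllPairs (λ ps qs → ∀ ρ → (⟦ C ⟧ (proj₁ ps) ρ ∧ ⟦ C ⟧ (proj₁ qs) ρ) ≡ false) ps
    → (∀ ρ → BL.or (map (λ ps → ⟦ C ⟧ (proj₁ ps) ρ) ps) ≡ true)
    → AllPairs (λ ps qs → ∃ λ ρ → ⟦ C ⟧ (proj₂ ps) ρ ≢ ⟦ C ⟧ (proj₂ qs) ρ) ps
    → SDDc C g T

IsSDDcFor : ∀ {V k} → Circ V (suc k) → ((V → Bool) → Bool) → Set
IsSDDcFor {V} C f =
  Σ (VTree V) λ T → IsVtreeFor V T × SDDc C zero T × (∀ ρ → ⟦ C ⟧ zero ρ ≡ f ρ)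

module Submission where
-- With w the number of true x-variables, F_n = [ y_w ↔ x_{max(w,1)} ].  We use
-- the vtree  node X Y  with X, Y right-linear over x₁…xₙ and y₀…yₙ.  At the
-- root the primes are the satisfiable [ w = i ∧ x_{max(i,1)} = b ] and the subs
-- the literals y_i^b: the primes partition the x-assignments and the subs are
-- pairwise distinct, so this is a compressed decomposition with O(n) elements.
-- Each prime lies in the counting family  [ #true = r ] ∧ [ p-th variable = b ]
-- over a suffix of x₁…xₙ; the Shannon cofactors of a member at its first
-- variable are members (or ⊥) and exclude each other, so every satisfiable
-- member is a compressed decomposition (u , ¬u) over the next suffix, costing
-- at most 6 arcs.  O(n²) members per suffix and n suffixes give O(n³) arcs.

open import Defs
open import Data.Nat using (ℕ; zero; suc; _+_; _*_; _^_; _≤_; _<_; z≤n; s≤s; _≡ᵇ_; _<ᵇ_; _≤?_; _<?_)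
import Data.Nat.Properties as ℕP
open import Data.Nat.Tactic.RingSolver using (solve-∀)
open import Data.Fin using (Fin; zero; suc; toℕ; fromℕ; fromℕ<; inject₁)
import Data.Fin.Properties as FinP
open import Data.Fin.Relation.Unary.Top using (view; ‵fromℕ; ‵inject₁)
open import Data.Bool using (Bool; true; false; _∧_; _∨_; not; if_then_else_)
import Data.Bool.Properties as BoolP
import Data.Bool.ListAction as BL
open import Data.Bool.ListAction using (any)
open import Data.Nat.ListAction using (sum)
open import Data.List using (List; []; _∷_; length; map; allFin; tabulate; upTo; cartesianProduct; filter; _++_)
import Data.List.Properties as ListP
open import Data.List.Membership.Propositional using (_∈_)
import Data.List.Membership.Propositional.Properties as ∈P
open import Data.List.Relation.Unary.Any using (here; there)
open import Data.List.Relation.Unary.All as All using (All; []; _∷_)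
import Data.List.Relation.Unary.All.Properties as AllP
open import Data.List.Relation.Unary.AllPairs as AllPairs using (AllPairs; []; _∷_)
import Data.List.Relation.Unary.AllPairs.Properties as AllPairsP
open import Data.List.Relation.Unary.Unique.Propositional using (Unique)
import Data.List.Relation.Unary.Unique.Propositional.Properties as UniqueP
open import Data.List.Relation.Binary.Pointwise using (Pointwise; []; _∷_)
open import Data.Maybe using (Maybe; just; nothing)
open import Data.Sum using (_⊎_; inj₁; inj₂)
import Data.Sum.Properties as SumP
open import Data.Product using (Σ; ∃; _×_; _,_; proj₁; proj₂)
open import Data.Empty using (⊥-elim)
open import Function using (_∘_; Equivalence)
open import Relation.Binary.PropositionalEquality
open import Relation.Binary using (DecidableEquality)
open import Relation.Nullary using (¬_; Dec; yes; no)
open import Relation.Unary using (Decidable)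

false≢true : false ≢ true
false≢true ()

BoolFn : Set → Set
BoolFn V = (V → Bool) → Bool

twice-plus-once : ∀ n → 2 * n + n ≡ 3 * n
twice-plus-once = solve-∀

-- Circuits are grown by appending gates.  Every construction below is a
-- "growth" of a given circuit, so that gates built earlier can be shared.

module _ {V : Set} where

  Property : Set₁
  Property = ∀ {k} → Circ V k → Set

  data Ext {k} (C : Circ V k) : ∀ {k'} → Circ V k' → Set where
    ε   : Ext C C
    _◂_ : ∀ {k'} {C' : Circ V k'} → Ext C C' → (h : Gate V k') → Ext C (C' ▷ h)

  _⊕_ : ∀ {k₁ k₂ k₃} {C₁ : Circ V k₁} {C₂ : Circ V k₂} {C₃ : Circ V k₃} →
        Ext C₁ C₂ → Ext C₂ C₃ → Ext C₁ C₃
  e ⊕ ε        = e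
  e ⊕ (e' ◂ h) = (e ⊕ e') ◂ h

  Stable : Property → Set
  Stable P = ∀ {k} {C : Circ V k} {h : Gate V k} → P C → P (C ▷ h)

  transport : ∀ {P : Property} → Stable P →
              ∀ {k k'} {C : Circ V k} {C' : Circ V k'} → Ext C C' → P C → P C'
  transport w ε       p = p
  transport w (e ◂ h) p = w (transport w e p)

  -- Appending a gate shifts every index by one and leaves subcircuits,
  -- and hence the compressed-SDD property, unchanged.
  sucPair : ∀ {k} → Fin k × Fin k → Fin (suc k) × Fin (suc k)
  sucPair (p , s) = suc p , suc s

  mutual
    weakenSDD : ∀ {k} {C : Circ V k} {h : Gate V k} {g T} → SDDc C g T → SDDc (C ▷ h) (suc g) T
    weakenSDD (sdd-lit eq le) = sdd-lit (cong (mapGate suc) eq) le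
    weakenSDD (sdd-const eq)  = sdd-const (cong (mapGate suc) eq)
    weakenSDD (sdd-dec nd as ps eq len shape primes subs sat disj cover distinct) =
      sdd-dec nd (map suc as) (map sucPair ps) (cong (mapGate suc) eq)
        (subst (2 ≤_) (sym (ListP.length-map suc as)) len)
        (weakenShape shape) (weakenPrimes primes) (weakenSubs subs)
        (AllP.map⁺ sat) (AllPairsP.map⁺ disj)
        (λ ρ → trans (cong BL.or (sym (ListP.map-∘ ps))) (cover ρ)) (AllPairsP.map⁺ distinct)

    weakenShape : ∀ {k} {C : Circ V k} {h : Gate V k} {as ps} →
      Pointwise (λ a ps → gateAt C a ≡ and (proj₁ ps ∷ proj₂ ps ∷ [])) as ps →
      Pointwise (λ a ps → gateAt (C ▷ h) a ≡ and (proj₁ ps ∷ proj₂ ps ∷ [])) (map suc as) (map sucPair ps)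
    weakenShape []       = []
    weakenShape (e ∷ es) = cong (mapGate suc) e ∷ weakenShape es

    weakenPrimes : ∀ {k} {C : Circ V k} {h : Gate V k} {l ps} →
      All (λ ps → Σ (VTree V) λ T → T ⊑ l × SDDc C (proj₁ ps) T) ps →
      All (λ ps → Σ (VTree V) λ T → T ⊑ l × SDDc (C ▷ h) (proj₁ ps) T) (map sucPair ps)
    weakenPrimes []                  = []
    weakenPrimes ((T , le , s) ∷ xs) = (T , le , weakenSDD s) ∷ weakenPrimes xs

    weakenSubs : ∀ {k} {C : Circ V k} {h : Gate V k} {r ps} →
      All (λ ps → Σ (VTree V) λ T → T ⊑ r × SDDc C (proj₂ ps) T) ps →
      All (λ ps → Σ (VTree V) λ T → T ⊑ r × SDDc (C ▷ h) (proj₂ ps) T) (map sucPair ps)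
    weakenSubs []                  = []
    weakenSubs ((T , le , s) ∷ xs) = (T , le , weakenSDD s) ∷ weakenSubs xs

  record Node {k} (C : Circ V k) (f : BoolFn V) (T : VTree V) : Set where
    constructor mkNode
    field
      gate     : Fin k
      computes : ∀ ρ → ⟦ C ⟧ gate ρ ≡ f ρ
      isSDD    : SDDc C gate T
  open Node public

  weakenNode : ∀ {f T} → Stable (λ C → Node C f T)
  weakenNode nd = mkNode (suc (gate nd)) (computes nd) (weakenSDD (isSDD nd))

  retarget : ∀ {k} {C : Circ V k} {f g T} → (∀ ρ → f ρ ≡ g ρ) → Node C f T → Node C g T
  retarget f≗g nd = mkNode (gate nd) (λ ρ → trans (computes nd ρ) (f≗g ρ)) (isSDD nd)

  literal : V → Bool → BoolFn V
  literal v b ρ = if b then ρ v else not (ρ v)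

  literalNode : ∀ {k} (C : Circ V k) v b → Node (C ▷ lit v b) (literal v b) (leaf v)
  literalNode C v b = mkNode zero (λ ρ → refl) (sdd-lit refl here)

  literal-true : ∀ {v b ρ} → literal v b ρ ≡ true → ρ v ≡ b
  literal-true {v} {true}  {ρ} h = h
  literal-true {v} {false} {ρ} h with ρ v
  ... | false = refl

  literal-intro : ∀ {v b ρ} → ρ v ≡ b → literal v b ρ ≡ true
  literal-intro {v} {true}  {ρ} e = e
  literal-intro {v} {false} {ρ} e rewrite e = refl

  literal-flip : ∀ {v b ρ} → ρ v ≡ not b → literal v b ρ ≡ false
  literal-flip {v} {true}  {ρ} e = e
  literal-flip {v} {false} {ρ} e rewrite e = refl

  literal-const : ∀ v b → literal v b (λ _ → true) ≡ b
  literal-const v true  = refl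
  literal-const v false = refl

  -- a constant-false gate, which is an SDD respecting every vtree
  record FalseGate {k} (C : Circ V k) : Set where
    constructor mkFalse
    field
      falseGate : Fin k
      isConst   : gateAt C falseGate ≡ const false
      isFalse   : ∀ ρ → ⟦ C ⟧ falseGate ρ ≡ false
  open FalseGate public

  weakenFalseGate : Stable FalseGate
  weakenFalseGate fg = mkFalse (suc (falseGate fg)) (cong (mapGate suc) (isConst fg)) (isFalse fg)

  Sat Unsat : BoolFn V → Set
  Sat   f = ∃ λ ρ → f ρ ≡ true
  Unsat f = ∀ ρ → f ρ ≡ false

  unsat⇒¬sat : ∀ {f} → Unsat f → ¬ Sat f
  unsat⇒¬sat u (ρ , t) with () ← trans (sym (u ρ)) t

  exclusive-distinct : ∀ {f g} → (∀ ρ → (f ρ ∧ g ρ) ≡ false) → Sat f ⊎ Sat g → ∃ λ ρ → f ρ ≢ g ρ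
  exclusive-distinct excl (inj₁ (ρ , fρ)) =
    ρ , λ f≡g → false≢true (trans (sym (excl ρ)) (cong₂ _∧_ fρ (trans (sym f≡g) fρ)))
  exclusive-distinct excl (inj₂ (ρ , gρ)) =
    ρ , λ f≡g → false≢true (trans (sym (excl ρ)) (cong₂ _∧_ (trans f≡g gρ) gρ))

  record Entry {k} (C : Circ V k) (f : BoolFn V) (T : VTree V) : Set where
    constructor mkEntry
    field
      entryNode : Node C f T
      status    : Sat f ⊎ Unsat f
  open Entry public

  weakenEntry : ∀ {f T} → Stable (λ C → Entry C f T)
  weakenEntry e = mkEntry (weakenNode (entryNode e)) (status e)

  retargetEntry : ∀ {k} {C : Circ V k} {f g T} → (∀ ρ → f ρ ≡ g ρ) → Entry C f T → Entry C g T
  retargetEntry {f = f} {g} f≗g (mkEntry nd st) = mkEntry (retarget f≗g nd) (status′ st)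
    where
    status′ : Sat f ⊎ Unsat f → Sat g ⊎ Unsat g
    status′ (inj₁ (ρ , t)) = inj₁ (ρ , trans (sym (f≗g ρ)) t)
    status′ (inj₂ u)       = inj₂ (λ ρ → trans (sym (f≗g ρ)) (u ρ))

  falseEntry : ∀ {k} {C : Circ V k} {f T} → FalseGate C → Unsat f → Entry C f T
  falseEntry fg u = mkEntry (mkNode (falseGate fg) (λ ρ → trans (isFalse fg ρ) (sym (u ρ))) (sdd-const (isConst fg))) (inj₂ u)

  satisfiable? : ∀ {f} → Sat f ⊎ Unsat f → Dec (Sat f)
  satisfiable? (inj₁ s) = yes s
  satisfiable? (inj₂ u) = no (unsat⇒¬sat u)

  record Grow {k} (C : Circ V k) (a : ℕ) (P : Property) : Set where
    constructor grow
    field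
      {k'}   : ℕ
      C'     : Circ V k'
      ext    : Ext C C'
      bound  : size C' ≤ size C + a
      result : P C'

  done : ∀ {k} {C : Circ V k} {P : Property} → P C → Grow C 0 P
  done {C = C} p = grow C ε (ℕP.m≤m+n _ 0) p

  appendGate : ∀ {k} {C : Circ V k} {P : Property} (h : Gate V k) → P (C ▷ h) → Grow C (fanin h) P
  appendGate h p = grow (_ ▷ h) (ε ◂ h) ℕP.≤-refl p

  mapGrow : ∀ {k a} {C : Circ V k} {P Q : Property} →
            (∀ {k'} {C' : Circ V k'} → P C' → Q C') → Grow C a P → Grow C a Q
  mapGrow f (grow C' e s p) = grow C' e s (f p)

  relax : ∀ {k a b} {C : Circ V k} {P : Property} → a ≤ b → Grow C a P → Grow C b P
  relax a≤b (grow C' e s p) = grow C' e (ℕP.≤-trans s (ℕP.+-monoʳ-≤ _ a≤b)) p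

  carry : ∀ {k a} {C : Circ V k} {P Q : Property} → Stable P → P C →
          Grow C a Q → Grow C a (λ C' → P C' × Q C')
  carry w p (grow C' e s q) = grow C' e s (transport w e p , q)

  _>>=_ : ∀ {k a b} {C : Circ V k} {P Q : Property} → Grow C a P →
          (∀ {k'} {C' : Circ V k'} → Ext C C' → P C' → Grow C' b Q) → Grow C (a + b) Q
  _>>=_ {a = a} {b} {C} (grow C₁ e₁ s₁ p) f with f e₁ p
  ... | grow C₂ e₂ s₂ q =
    grow C₂ (e₁ ⊕ e₂) (ℕP.≤-trans s₂ (ℕP.≤-trans (ℕP.+-monoˡ-≤ b s₁) (ℕP.≤-reflexive (ℕP.+-assoc (size C) a b)))) q

  growEach : {K : Set} {a : ℕ} {Aux : Property} (R : K → Property) →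
    (∀ {key} → Stable (R key)) → Stable Aux →
    (∀ {k} {C : Circ V k} → Aux C → (key : K) → Grow C a (R key)) →
    ∀ {k} {C : Circ V k} → Aux C → (keys : List K) →
    Grow C (length keys * a) (λ C' → Aux C' × All (λ key → R key C') keys)
  growEach R wR wA task aux []           = mapGrow (λ aux' → aux' , []) (done aux)
  growEach R wR wA task aux (key ∷ keys) =
    task aux key >>= λ e r →
      mapGrow (λ (r' , aux' , rs) → aux' , r' ∷ rs)
        (carry wR r (growEach R wR wA task (transport wA e aux) keys))

  record Element : Set where
    constructor element
    field
      prime sub           : BoolFn V
      primeTree subTree   : VTree V
  open Element public

  disjunction : List Element → BoolFn V
  disjunction es ρ = BL.or (map (λ e → prime e ρ ∧ sub e ρ) es)

  record Decomposition (l r : VTree V) (es : List Element) : Set where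
    field
      primesLeft     : All (λ e → primeTree e ⊑ l) es
      subsRight      : All (λ e → subTree e ⊑ r) es
      atLeastTwo     : 2 ≤ length es
      primesSat      : All (λ e → Sat (prime e)) es
      primesDisjoint : AllPairs (λ e e' → ∀ ρ → (prime e ρ ∧ prime e' ρ) ≡ false) es
      primesCover    : ∀ ρ → BL.or (map (λ e → prime e ρ) es) ≡ true
      subsDistinct   : AllPairs (λ e e' → ∃ λ ρ → sub e ρ ≢ sub e' ρ) es

  Realised : ∀ {k} → Circ V k → Element → Set
  Realised C e = Node C (prime e) (primeTree e) × Node C (sub e) (subTree e)

  weakenRealised : ∀ {e} → Stable (λ C → Realised C e)
  weakenRealised (p , s) = weakenNode p , weakenNode s

  record Conjunct {k} (C : Circ V k) (e : Element) : Set where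
    constructor mkConjunct
    field
      andGate   : Fin k
      primeNode : Node C (prime e) (primeTree e)
      subNode   : Node C (sub e) (subTree e)
      shape     : gateAt C andGate ≡ and (gate primeNode ∷ gate subNode ∷ [])
      conjoins  : ∀ ρ → ⟦ C ⟧ andGate ρ ≡ (prime e ρ ∧ sub e ρ)
  open Conjunct public

  weakenConjunct : ∀ {e} → Stable (λ C → Conjunct C e)
  weakenConjunct c = mkConjunct (suc (andGate c)) (weakenNode (primeNode c)) (weakenNode (subNode c))
                       (cong (mapGate suc) (shape c)) (conjoins c)

  conjoin : ∀ {k} {C : Circ V k} {e} → Realised C e → Grow C 2 (λ C' → Conjunct C' e)
  conjoin {C = C} (p , s) =
    appendGate (and (gate p ∷ gate s ∷ []))
      (mkConjunct zero (weakenNode p) (weakenNode s) refl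
        (λ ρ → trans (cong (⟦ C ⟧ (gate p) ρ ∧_) (BoolP.∧-identityʳ _)) (cong₂ _∧_ (computes p ρ) (computes s ρ))))

  appendConjuncts : ∀ {k} {C : Circ V k} {es} → All (Realised C) es →
                    Grow C (2 * length es) (λ C' → All (Conjunct C') es)
  appendConjuncts []                = relax z≤n (done [])
  appendConjuncts {es = _ ∷ es} (r ∷ rs) =
    relax (ℕP.≤-reflexive (sym (ℕP.*-suc 2 (length es))))
      (conjoin r >>= λ e c →
         mapGrow (λ (c' , cs) → c' ∷ cs) (carry weakenConjunct c (appendConjuncts (All.map (transport weakenRealised e) rs))))

  module _ {k} {C : Circ V k} where
    andGates : ∀ {es} → All (Conjunct C) es → List (Fin k)
    andGates []       = []
    andGates (c ∷ cs) = andGate c ∷ andGates cs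

    pairs : ∀ {es} → All (Conjunct C) es → List (Fin k × Fin k)
    pairs []       = []
    pairs (c ∷ cs) = (gate (primeNode c) , gate (subNode c)) ∷ pairs cs

    length-andGates : ∀ {es} (cs : All (Conjunct C) es) → length (andGates cs) ≡ length es
    length-andGates []       = refl
    length-andGates (c ∷ cs) = cong suc (length-andGates cs)

    shapes : ∀ {es} (cs : All (Conjunct C) es) →
      Pointwise (λ a ps → gateAt C a ≡ and (proj₁ ps ∷ proj₂ ps ∷ [])) (andGates cs) (pairs cs)
    shapes []       = []
    shapes (c ∷ cs) = shape c ∷ shapes cs

    transferAll : ∀ {Q : Element → Set} {R : Fin k × Fin k → Set} →
      (∀ {e} (c : Conjunct C e) → Q e → R (gate (primeNode c) , gate (subNode c))) →
      ∀ {es} → All Q es → (cs : All (Conjunct C) es) → All R (pairs cs)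
    transferAll f []       []       = []
    transferAll f (q ∷ qs) (c ∷ cs) = f c q ∷ transferAll f qs cs

    transferPairs : ∀ {Q : Element → Element → Set} {R : Fin k × Fin k → Fin k × Fin k → Set} →
      (∀ {e e'} (c : Conjunct C e) (c' : Conjunct C e') → Q e e' →
         R (gate (primeNode c) , gate (subNode c)) (gate (primeNode c') , gate (subNode c'))) →
      ∀ {es} → AllPairs Q es → (cs : All (Conjunct C) es) → AllPairs R (pairs cs)
    transferPairs f []       []       = []
    transferPairs {Q} {R} f (q ∷ qs) (c ∷ cs) =
      transferAll {Q = Q _} {R = R _} (f c) q cs ∷ transferPairs f qs cs

    primeValues : ∀ {es} (cs : All (Conjunct C) es) ρ →
      map (λ ps → ⟦ C ⟧ (proj₁ ps) ρ) (pairs cs) ≡ map (λ e → prime e ρ) es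
    primeValues []       ρ = refl
    primeValues (c ∷ cs) ρ = cong₂ _∷_ (computes (primeNode c) ρ) (primeValues cs ρ)

    andValues : ∀ {es} (cs : All (Conjunct C) es) ρ →
      map (evalAll C ρ) (andGates cs) ≡ map (λ e → prime e ρ ∧ sub e ρ) es
    andValues []       ρ = refl
    andValues (c ∷ cs) ρ = cong₂ _∷_ (conjoins c ρ) (andValues cs ρ)

  andGates-weaken : ∀ {k} {C : Circ V k} {h : Gate V k} {es} (cs : All (Conjunct C) es) →
    andGates (All.map (weakenConjunct {h = h}) cs) ≡ map suc (andGates cs)
  andGates-weaken []       = refl
  andGates-weaken (c ∷ cs) = cong (suc (andGate c) ∷_) (andGates-weaken cs)

  decisionGate : ∀ {k} {C : Circ V k} {l r es} → Decomposition l r es → (cs : All (Conjunct C) es) →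
    SDDc (C ▷ or (andGates cs)) zero (node l r) × (∀ ρ → ⟦ C ▷ or (andGates cs) ⟧ zero ρ ≡ disjunction es ρ)
  decisionGate {C = C} {es = es} D cs =
    sdd-dec here (andGates cs') (pairs cs') (cong or (sym (andGates-weaken cs)))
      (subst (2 ≤_) (sym (length-andGates cs')) atLeastTwo) (shapes cs')
      (transferAll (λ c t → _ , t , isSDD (primeNode c)) primesLeft cs')
      (transferAll (λ c t → _ , t , isSDD (subNode c)) subsRight cs')
      (transferAll (λ c (ρ , t) → ρ , trans (computes (primeNode c) ρ) t) primesSat cs')
      (transferPairs (λ c c' d ρ → trans (cong₂ _∧_ (computes (primeNode c) ρ) (computes (primeNode c') ρ)) (d ρ))
                     primesDisjoint cs')
      (λ ρ → trans (cong BL.or (primeValues cs' ρ)) (primesCover ρ))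
      (transferPairs (λ c c' (ρ , d) → ρ , λ q → d (trans (sym (computes (subNode c) ρ)) (trans q (computes (subNode c') ρ))))
                     subsDistinct cs')
    , λ ρ → cong BL.or (andValues cs ρ)
    where
    open Decomposition D
    cs' : All (Conjunct (C ▷ or (andGates cs))) es
    cs' = All.map (weakenConjunct {h = or (andGates cs)}) cs

  data Rooted (f : BoolFn V) (T : VTree V) : ∀ {k} → Circ V k → Set where
    rooted : ∀ {k} {C : Circ V k} {h : Gate V k} →
             SDDc (C ▷ h) zero T → (∀ ρ → ⟦ C ▷ h ⟧ zero ρ ≡ f ρ) → Rooted f T (C ▷ h)

  rootNode : ∀ {k} {C : Circ V k} {f T} → Rooted f T C → Node C f T
  rootNode (rooted sdd val) = mkNode zero val sdd

  retargetRooted : ∀ {k} {C : Circ V k} {f g T} → (∀ ρ → f ρ ≡ g ρ) → Rooted f T C → Rooted g T C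
  retargetRooted f≗g (rooted sdd val) = rooted sdd (λ ρ → trans (val ρ) (f≗g ρ))

  output : ∀ {k a f T} {C : Circ V k} → IsVtreeFor V T → Grow C a (Rooted f T) →
           Σ ℕ λ j → Σ (Circ V (suc j)) λ C' → IsSDDcFor C' f × size C' ≤ size C + a
  output vt (grow _ _ bound (rooted sdd val)) = _ , _ , (_ , vt , sdd , val) , bound

  decide : ∀ {k} {C : Circ V k} {l r es} → Decomposition l r es → All (Realised C) es →
           Grow C (3 * length es) (Rooted (disjunction es) (node l r))
  decide {es = es} D rs =
    relax (ℕP.≤-reflexive (twice-plus-once (length es)))
      (appendConjuncts rs >>= λ _ cs →
         relax (ℕP.≤-reflexive (length-andGates cs))
           (appendGate (or (andGates cs)) (let (sdd , val) = decisionGate D cs in rooted sdd val)))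

bool-ext : ∀ {a b : Bool} → (a ≡ true → b ≡ true) → (b ≡ true → a ≡ true) → a ≡ b
bool-ext {false} {false} _ _ = refl
bool-ext {false} {true}  _ g = g refl
bool-ext {true}  {false} f _ = sym (f refl)
bool-ext {true}  {true}  _ _ = refl

≡ᵇ-refl : ∀ n → (n ≡ᵇ n) ≡ true
≡ᵇ-refl n = Equivalence.to BoolP.T-≡ (ℕP.≡⇒≡ᵇ n n refl)

≡ᵇ-true : ∀ m n → (m ≡ᵇ n) ≡ true → m ≡ n
≡ᵇ-true m n e = ℕP.≡ᵇ⇒≡ m n (Equivalence.from BoolP.T-≡ e)

≡ᵇ-false : ∀ m n → m ≢ n → (m ≡ᵇ n) ≡ false
≡ᵇ-false m n m≢n with m ≡ᵇ n in e
... | true  = ⊥-elim (m≢n (≡ᵇ-true m n e))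
... | false = refl

if-as-or : ∀ c (f : Bool → Bool) → ((c ∧ f true) ∨ ((not c ∧ f false) ∨ false)) ≡ f c
if-as-or true  f = BoolP.∨-identityʳ (f true)
if-as-or false f = BoolP.∨-identityʳ (f false)

module _ {A : Set} where

  or-member : ∀ (g : A → Bool) {a L} → a ∈ L → g a ≡ true → BL.or (map g L) ≡ true
  or-member g (here refl) ga rewrite ga = refl
  or-member g {L = b ∷ L} (there a∈L) ga = trans (cong (g b ∨_) (or-member g a∈L ga)) (BoolP.∨-zeroʳ _)

  or-witness : ∀ (g : A → Bool) L → BL.or (map g L) ≡ true → ∃ λ a → a ∈ L × g a ≡ true
  or-witness g (a ∷ L) h with g a in ga
  ... | true  = a , here refl , ga
  ... | false with b , b∈L , gb ← or-witness g L h = b , there b∈L , gb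

  or-false : ∀ (g : A → Bool) L → (∀ a → g a ≡ false) → BL.or (map g L) ≡ false
  or-false g []      _ = refl
  or-false g (a ∷ L) h rewrite h a = or-false g L h

  or-unique : ∀ (g : A → Bool) {a₀ L} → a₀ ∈ L → (∀ a → g a ≡ true → a ≡ a₀) → BL.or (map g L) ≡ g a₀
  or-unique g {a₀} {L} a₀∈L only = bool-ext to (or-member g a₀∈L)
    where
    to : BL.or (map g L) ≡ true → g a₀ ≡ true
    to h with a , _ , ga ← or-witness g L h = subst (λ z → g z ≡ true) (only a ga) ga

  or-filter : ∀ {P : A → Set} (P? : Decidable P) (g : A → Bool) → (∀ a → ¬ P a → g a ≡ false) →
              ∀ L → BL.or (map g (filter P? L)) ≡ BL.or (map g L)
  or-filter P? g drop [] = refl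
  or-filter P? g drop (a ∷ L) with P? a
  ... | yes _  = cong (g a ∨_) (or-filter P? g drop L)
  ... | no ¬Pa rewrite drop a ¬Pa = or-filter P? g drop L

  nonempty : ∀ {a : A} {L} → a ∈ L → 1 ≤ length L
  nonempty (here _)  = s≤s z≤n
  nonempty (there _) = s≤s z≤n

  two-members : ∀ {a b : A} {L} → a ∈ L → b ∈ L → a ≢ b → 2 ≤ length L
  two-members (here refl) (here refl)  a≢b = ⊥-elim (a≢b refl)
  two-members (here refl) (there b∈L)  _   = s≤s (nonempty b∈L)
  two-members (there a∈L) (here refl)  _   = s≤s (nonempty a∈L)
  two-members (there a∈L) (there b∈L) a≢b = ℕP.m≤n⇒m≤1+n (two-members a∈L b∈L a≢b)

length-cartesianProduct : ∀ {A B : Set} (as : List A) (bs : List B) →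
  length (cartesianProduct as bs) ≡ length as * length bs
length-cartesianProduct []       bs = refl
length-cartesianProduct (a ∷ as) bs =
  trans (ListP.length-++ (map (a ,_) bs)) (cong₂ _+_ (ListP.length-map (a ,_) bs) (length-cartesianProduct as bs))

bools : List Bool
bools = false ∷ true ∷ []

∈-bools : ∀ b → b ∈ bools
∈-bools false = here refl
∈-bools true  = there (here refl)

bools-unique : Unique bools
bools-unique = ((λ ()) ∷ []) ∷ [] ∷ []

≡ᵇ-exclusive : ∀ c r → ((c ≡ᵇ r) ∧ (c ≡ᵇ suc r)) ≡ false
≡ᵇ-exclusive zero    zero    = refl
≡ᵇ-exclusive zero    (suc r) = refl
≡ᵇ-exclusive (suc c) zero    = refl
≡ᵇ-exclusive (suc c) (suc r) = ≡ᵇ-exclusive c r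

∧-exclusive : ∀ a b c → (a ∧ b) ≡ false → ((a ∧ c) ∧ (b ∧ c)) ≡ false
∧-exclusive false b     c _  = refl
∧-exclusive true  false c _  = BoolP.∧-zeroʳ _

-- The Shannon cofactors of Q (u ∷ xs) key are again members of the family
-- over xs (or ⊥), and the two cofactors exclude each other.

Key : Set
Key = ℕ × Maybe (ℕ × Bool)

-- the key of the cofactor of  Q (u ∷ xs) key  at  u = c
cofactor : Bool → Key → Maybe Key
cofactor true  (zero  , _)                  = nothing
cofactor true  (suc r , nothing)            = just (r , nothing)
cofactor true  (suc r , just (zero , true))  = just (r , nothing)
cofactor true  (suc r , just (zero , false)) = nothing
cofactor true  (suc r , just (suc p , b))   = just (r , just (p , b))
cofactor false (r , nothing)                = just (r , nothing)
cofactor false (r , just (zero , true))     = nothing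
cofactor false (r , just (zero , false))    = just (r , nothing)
cofactor false (r , just (suc p , b))       = just (r , just (p , b))

module _ {V : Set} where

  count : List V → (V → Bool) → ℕ
  count xs ρ = sum (map (λ v → if ρ v then 1 else 0) xs)

  mark : List V → ℕ → Bool → BoolFn V
  mark []       p       b ρ = false
  mark (v ∷ vs) zero    b ρ = literal v b ρ
  mark (v ∷ vs) (suc p) b ρ = mark vs p b ρ

  Q : List V → Key → BoolFn V
  Q xs (r , nothing)      ρ = count xs ρ ≡ᵇ r
  Q xs (r , just (p , b)) ρ = (count xs ρ ≡ᵇ r) ∧ mark xs p b ρ

  Q? : List V → Maybe Key → BoolFn V
  Q? xs nothing    ρ = false
  Q? xs (just key) ρ = Q xs key ρ

  shannon : ∀ u xs key ρ → Q (u ∷ xs) key ρ ≡ Q? xs (cofactor (ρ u) key) ρ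
  shannon u xs (r , nothing) ρ with ρ u
  shannon u xs (zero  , nothing) ρ | true  = refl
  shannon u xs (suc r , nothing) ρ | true  = refl
  shannon u xs (r     , nothing) ρ | false = refl
  shannon u xs (r , just (zero , b)) ρ with ρ u
  shannon u xs (zero  , just (zero , b))     ρ | true  = refl
  shannon u xs (suc r , just (zero , true))  ρ | true  = BoolP.∧-identityʳ _
  shannon u xs (suc r , just (zero , false)) ρ | true  = BoolP.∧-zeroʳ _
  shannon u xs (r     , just (zero , true))  ρ | false = BoolP.∧-zeroʳ _
  shannon u xs (r     , just (zero , false)) ρ | false = BoolP.∧-identityʳ _
  shannon u xs (r , just (suc p , b)) ρ with ρ u
  shannon u xs (zero  , just (suc p , b)) ρ | true  = refl
  shannon u xs (suc r , just (suc p , b)) ρ | true  = refl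
  shannon u xs (r     , just (suc p , b)) ρ | false = refl

  cofactors-exclusive : ∀ xs key ρ → (Q? xs (cofactor true key) ρ ∧ Q? xs (cofactor false key) ρ) ≡ false
  cofactors-exclusive xs (zero  , _)                  ρ = refl
  cofactors-exclusive xs (suc r , nothing)            ρ = ≡ᵇ-exclusive (count xs ρ) r
  cofactors-exclusive xs (suc r , just (zero , true))  ρ = BoolP.∧-zeroʳ _
  cofactors-exclusive xs (suc r , just (zero , false)) ρ = refl
  cofactors-exclusive xs (suc r , just (suc p , b))   ρ =
    ∧-exclusive (count xs ρ ≡ᵇ r) _ (mark xs p b ρ) (≡ᵇ-exclusive (count xs ρ) r)

  count-local : ∀ {ρ ρ'} xs → All (λ v → ρ v ≡ ρ' v) xs → count xs ρ ≡ count xs ρ'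
  count-local []       []       = refl
  count-local (v ∷ vs) (e ∷ es) = cong₂ _+_ (cong (λ b → if b then 1 else 0) e) (count-local vs es)

  mark-local : ∀ {ρ ρ'} xs p b → All (λ v → ρ v ≡ ρ' v) xs → mark xs p b ρ ≡ mark xs p b ρ'
  mark-local []       p       b []       = refl
  mark-local (v ∷ vs) zero    b (e ∷ es) = cong (λ z → if b then z else not z) e
  mark-local (v ∷ vs) (suc p) b (e ∷ es) = mark-local vs p b es

  Q?-local : ∀ {ρ ρ'} xs mk → All (λ v → ρ v ≡ ρ' v) xs → Q? xs mk ρ ≡ Q? xs mk ρ'
  Q?-local xs nothing                  _ = refl
  Q?-local xs (just (r , nothing))     a = cong (_≡ᵇ r) (count-local xs a)
  Q?-local xs (just (r , just (p , b))) a =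
    cong₂ (λ c z → (c ≡ᵇ r) ∧ z) (count-local xs a) (mark-local xs p b a)

  count≤length : ∀ xs ρ → count xs ρ ≤ length xs
  count≤length []       ρ = z≤n
  count≤length (v ∷ vs) ρ with ρ v
  ... | true  = s≤s (count≤length vs ρ)
  ... | false = ℕP.m≤n⇒m≤1+n (count≤length vs ρ)

  count-none : ∀ xs → count xs (λ _ → false) ≡ 0
  count-none []       = refl
  count-none (v ∷ vs) = count-none vs

  count-all : ∀ xs → count xs (λ _ → true) ≡ length xs
  count-all []       = refl
  count-all (v ∷ vs) = cong suc (count-all vs)

  count-zero : ∀ xs ρ → count xs ρ ≡ 0 → All (λ v → ρ v ≡ false) xs
  count-zero []       ρ _ = []
  count-zero (v ∷ vs) ρ h with ρ v in e
  ... | false = e ∷ count-zero vs ρ h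

  count-full : ∀ xs ρ → count xs ρ ≡ length xs → All (λ v → ρ v ≡ true) xs
  count-full []       ρ _ = []
  count-full (v ∷ vs) ρ h with ρ v in e
  ... | true  = e ∷ count-full vs ρ (ℕP.suc-injective h)
  ... | false = ⊥-elim (ℕP.<⇒≢ (s≤s (count≤length vs ρ)) h)

  mark-tabulate : ∀ {k} (g : Fin k → V) j b ρ → mark (tabulate g) (toℕ j) b ρ ≡ literal (g j) b ρ
  mark-tabulate g zero    b ρ = refl
  mark-tabulate g (suc j) b ρ = mark-tabulate (g ∘ suc) j b ρ

  count-mismatch : ∀ xs r ρ → length xs < r → (count xs ρ ≡ᵇ r) ≡ false
  count-mismatch xs r ρ lt = ≡ᵇ-false (count xs ρ) r (ℕP.<⇒≢ (ℕP.≤-<-trans (count≤length xs ρ) lt))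

  Q-count-range : ∀ xs r M ρ → length xs < r → Q xs (r , M) ρ ≡ false
  Q-count-range xs r nothing        ρ lt = count-mismatch xs r ρ lt
  Q-count-range xs r (just (p , b)) ρ lt rewrite count-mismatch xs r ρ lt = refl

  mark-range : ∀ xs p b ρ → length xs ≤ p → mark xs p b ρ ≡ false
  mark-range []       p       b ρ _        = refl
  mark-range (v ∷ vs) (suc p) b ρ (s≤s le) = mark-range vs p b ρ le

  Q-mark-range : ∀ xs r p b ρ → length xs ≤ p → Q xs (r , just (p , b)) ρ ≡ false
  Q-mark-range xs r p b ρ le rewrite mark-range xs p b ρ le = BoolP.∧-zeroʳ _

  module Update (_≟_ : DecidableEquality V) where
    _[_≔_] : (V → Bool) → V → Bool → V → Bool
    (ρ [ u ≔ b ]) v with v ≟ u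
    ... | yes _ = b
    ... | no  _ = ρ v

    update-same : ∀ ρ u b → (ρ [ u ≔ b ]) u ≡ b
    update-same ρ u b with u ≟ u
    ... | yes _   = refl
    ... | no  u≢u = ⊥-elim (u≢u refl)

    update-other : ∀ ρ u b v → u ≢ v → (ρ [ u ≔ b ]) v ≡ ρ v
    update-other ρ u b v u≢v with v ≟ u
    ... | yes v≡u = ⊥-elim (u≢v (sym v≡u))
    ... | no  _   = refl

    cofactor-sat : ∀ {u xs} → All (u ≢_) xs → ∀ c key → Sat (Q? xs (cofactor c key)) → Sat (Q (u ∷ xs) key)
    cofactor-sat {u} {xs} u∉xs c key (ρ , h) = ρ' , (begin
        Q (u ∷ xs) key ρ'               ≡⟨ shannon u xs key ρ' ⟩
        Q? xs (cofactor (ρ' u) key) ρ'  ≡⟨ cong (λ c' → Q? xs (cofactor c' key) ρ') (update-same ρ u c) ⟩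
        Q? xs (cofactor c key) ρ'       ≡⟨ Q?-local xs (cofactor c key) (All.map (update-other ρ u c _) u∉xs) ⟩
        Q? xs (cofactor c key) ρ        ≡⟨ h ⟩
        true                            ∎)
      where
      open ≡-Reasoning
      ρ' : V → Bool
      ρ' = ρ [ u ≔ c ]

  chain : V → List V → VTree V
  chain u []       = leaf u
  chain u (v ∷ vs) = node (leaf u) (chain v vs)

  leaves-chain : ∀ u vs → leaves (chain u vs) ≡ u ∷ vs
  leaves-chain u []       = refl
  leaves-chain u (v ∷ vs) = cong (u ∷_) (leaves-chain v vs)

  leaf⊑chain : ∀ {w} u vs → w ∈ u ∷ vs → leaf w ⊑ chain u vs
  leaf⊑chain u []       (here refl)  = here
  leaf⊑chain u (v ∷ vs) (here refl)  = inl here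
  leaf⊑chain u (v ∷ vs) (there w∈vs) = inr (leaf⊑chain v vs w∈vs)

-- Compressed SDDs for every member of the counting family, along a
-- right-linear vtree: the table for u ∷ vs is obtained from the table for
-- vs by one Shannon decomposition per key, at cost at most 6 per key.

module Tables {V : Set} (_≟_ : DecidableEquality V) (N : ℕ) where
  open Update _≟_

  -- the keys that can be satisfiable on lists of length at most N
  keys : List Key
  keys = cartesianProduct (upTo (suc N)) (nothing ∷ map just (cartesianProduct (upTo N) bools))

  length-keys : length keys ≡ suc N * suc (N * 2)
  length-keys = begin
    length keys
      ≡⟨ length-cartesianProduct (upTo (suc N)) (nothing ∷ map just marks) ⟩
    length (upTo (suc N)) * suc (length (map just (cartesianProduct (upTo N) bools)))
      ≡⟨ cong₂ (λ a b → a * suc b) (ListP.length-upTo (suc N))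
               (trans (ListP.length-map just marks) (length-cartesianProduct (upTo N) bools)) ⟩
    suc N * suc (length (upTo N) * 2)
      ≡⟨ cong (λ a → suc N * suc (a * 2)) (ListP.length-upTo N) ⟩
    suc N * suc (N * 2) ∎
    where
    open ≡-Reasoning
    marks : List (ℕ × Bool)
    marks = cartesianProduct (upTo N) bools

  -- entries for the listed keys determine all entries: the others give ⊥
  complete : ∀ {k} {C : Circ V k} {xs T} → length xs ≤ N → FalseGate C →
    All (λ key → Entry C (Q xs key) T) keys → ∀ key → Entry C (Q xs key) T
  complete {xs = xs} len fg entries (r , M) with r ≤? N
  ... | no r≰N = falseEntry fg (λ ρ → Q-count-range xs r M ρ (ℕP.≤-<-trans len (ℕP.≰⇒> r≰N)))
  complete len fg entries (r , nothing) | yes r≤N =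
    All.lookup entries (∈P.∈-cartesianProduct⁺ (∈P.∈-upTo⁺ (s≤s r≤N)) (here refl))
  complete {xs = xs} len fg entries (r , just (p , b)) | yes r≤N with p <? N
  ... | yes p<N = All.lookup entries
        (∈P.∈-cartesianProduct⁺ (∈P.∈-upTo⁺ (s≤s r≤N))
          (there (∈P.∈-map⁺ just (∈P.∈-cartesianProduct⁺ (∈P.∈-upTo⁺ p<N) (∈-bools b)))))
  ... | no p≮N  = falseEntry fg (λ ρ → Q-mark-range xs r p b ρ (ℕP.≤-trans len (ℕP.≮⇒≥ p≮N)))

  Table : ∀ {k} → Circ V k → V → List V → Set
  Table C u vs = ∀ key → Entry C (Q (u ∷ vs) key) (chain u vs)

  weakenTable : ∀ {u vs} → Stable (λ C → Table C u vs)
  weakenTable t key = weakenEntry (t key)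

  cofactorEntry : ∀ {k} {C : Circ V k} {v vs} → FalseGate C → Table C v vs →
                  ∀ mk → Entry C (Q? (v ∷ vs) mk) (chain v vs)
  cofactorEntry fg table nothing    = falseEntry fg (λ _ → refl)
  cofactorEntry fg table (just key) = table key

  literals : ∀ {k} {C : Circ V k} u →
    Grow C 0 (λ C' → Node C' (literal u true) (leaf u) × Node C' (literal u false) (leaf u))
  literals u = appendGate (lit u true) (literalNode _ u true) >>= λ _ pos →
                 carry weakenNode pos (appendGate (lit u false) (literalNode _ u false))

  -- On a single variable u a member of the family is ⊥, u or ¬u,
  -- since its two cofactors are constants that exclude each other.
  singleEntry : ∀ {k} {C : Circ V k} u (f : Bool → Bool) → (f true ∧ f false) ≡ false → FalseGate C →
    Node C (literal u true) (leaf u) → Node C (literal u false) (leaf u) → Entry C (λ ρ → f (ρ u)) (leaf u)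
  singleEntry u f excl fg pos neg with f true in e₁ | f false in e₀
  ... | false | false = falseEntry fg (λ ρ → on (ρ u))
    where
    on : ∀ c → f c ≡ false
    on true  = e₁
    on false = e₀
  ... | true  | false = mkEntry (retarget (λ ρ → on (ρ u)) pos) (inj₁ ((λ _ → true) , e₁))
    where
    on : ∀ c → c ≡ f c
    on true  = sym e₁
    on false = sym e₀
  ... | false | true  = mkEntry (retarget (λ ρ → on (ρ u)) neg) (inj₁ ((λ _ → false) , e₀))
    where
    on : ∀ c → not c ≡ f c
    on true  = sym e₁
    on false = sym e₀
  ... | true  | true  = ⊥-elim (false≢true (sym excl))

  baseTable : ∀ {k} {C : Circ V k} u → FalseGate C → Grow C 0 (λ C' → FalseGate C' × Table C' u [])
  baseTable u fg = literals u >>= λ e (pos , neg) →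
    let fg' = transport weakenFalseGate e fg in
    done (fg' , λ key →
      retargetEntry (λ ρ → sym (trans (shannon u [] key ρ) (Q?-local [] (cofactor (ρ u) key) [])))
        (singleEntry u (λ c → Q? [] (cofactor c key) (λ _ → false))
           (cofactors-exclusive [] key (λ _ → false)) fg' pos neg))

  StepAux : ∀ {k} → Circ V k → V → V → List V → Set
  StepAux C u v vs = FalseGate C × Table C v vs × Node C (literal u true) (leaf u) × Node C (literal u false) (leaf u)

  weakenStepAux : ∀ {u v vs} → Stable (λ C → StepAux C u v vs)
  weakenStepAux (fg , t , pos , neg) = weakenFalseGate fg , weakenTable t , weakenNode pos , weakenNode neg

  shannonElements : V → V → List V → Key → List Element
  shannonElements u v vs key =
    element (literal u true)  (Q? (v ∷ vs) (cofactor true key))  (leaf u) (chain v vs) ∷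
    element (literal u false) (Q? (v ∷ vs) (cofactor false key)) (leaf u) (chain v vs) ∷ []

  shannonDecomposition : ∀ u v vs key →
    Sat (Q? (v ∷ vs) (cofactor true key)) ⊎ Sat (Q? (v ∷ vs) (cofactor false key)) →
    Decomposition (leaf u) (chain v vs) (shannonElements u v vs key)
  shannonDecomposition u v vs key someSat = record
    { primesLeft     = here ∷ here ∷ []
    ; subsRight      = here ∷ here ∷ []
    ; atLeastTwo     = s≤s (s≤s z≤n)
    ; primesSat      = ((λ _ → true) , refl) ∷ ((λ _ → false) , refl) ∷ []
    ; primesDisjoint = ((λ ρ → BoolP.∧-inverseʳ (ρ u)) ∷ []) ∷ [] ∷ []
    ; primesCover    = λ ρ → trans (cong (ρ u ∨_) (BoolP.∨-identityʳ _)) (BoolP.∨-inverseʳ (ρ u))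
    ; subsDistinct   = (exclusive-distinct (cofactors-exclusive (v ∷ vs) key) someSat ∷ []) ∷ [] ∷ []
    }

  shannonEntry : ∀ {u v vs} → All (u ≢_) (v ∷ vs) → ∀ {k} {C : Circ V k} → StepAux C u v vs →
    (key : Key) → Grow C 6 (λ C' → Entry C' (Q (u ∷ v ∷ vs) key) (chain u (v ∷ vs)))
  shannonEntry {u} {v} {vs} u∉ {C = C} (fg , table , pos , neg) key = build (status e₁) (status e₀)
    where
    f₁ f₀ : BoolFn V
    f₁ = Q? (v ∷ vs) (cofactor true key)
    f₀ = Q? (v ∷ vs) (cofactor false key)
    e₁ : Entry C f₁ (chain v vs)
    e₁ = cofactorEntry fg table (cofactor true key)
    e₀ : Entry C f₀ (chain v vs)
    e₀ = cofactorEntry fg table (cofactor false key)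

    Result : Property
    Result C' = Entry C' (Q (u ∷ v ∷ vs) key) (chain u (v ∷ vs))

    value : ∀ ρ → disjunction (shannonElements u v vs key) ρ ≡ Q (u ∷ v ∷ vs) key ρ
    value ρ = trans (if-as-or (ρ u) (λ c → Q? (v ∷ vs) (cofactor c key) ρ)) (sym (shannon u (v ∷ vs) key ρ))

    satisfied : Sat f₁ ⊎ Sat f₀ → Sat (Q (u ∷ v ∷ vs) key)
    satisfied (inj₁ s) = cofactor-sat u∉ true key s
    satisfied (inj₂ s) = cofactor-sat u∉ false key s

    decomposed : Sat f₁ ⊎ Sat f₀ → Grow C 6 Result
    decomposed someSat =
      mapGrow (λ r → mkEntry (retarget value (rootNode r)) (inj₁ (satisfied someSat)))
        (decide (shannonDecomposition u v vs key someSat) ((pos , entryNode e₁) ∷ (neg , entryNode e₀) ∷ []))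

    build : Sat f₁ ⊎ Unsat f₁ → Sat f₀ ⊎ Unsat f₀ → Grow C 6 Result
    build (inj₁ s₁) _         = decomposed (inj₁ s₁)
    build (inj₂ _)  (inj₁ s₀) = decomposed (inj₂ s₀)
    build (inj₂ u₁) (inj₂ u₀) = relax z≤n (done (falseEntry fg (λ ρ → trans (shannon u _ key ρ) (both ρ (ρ u)))))
      where
      both : ∀ ρ c → Q? (v ∷ vs) (cofactor c key) ρ ≡ false
      both ρ true  = u₁ ρ
      both ρ false = u₀ ρ

  stepCost : ℕ
  stepCost = length keys * 6

  extendTable : ∀ {k} {C : Circ V k} {u v vs} → All (u ≢_) (v ∷ vs) → length (u ∷ v ∷ vs) ≤ N →
    FalseGate C → Table C v vs → Grow C stepCost (λ C' → FalseGate C' × Table C' u (v ∷ vs))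
  extendTable {u = u} {v} {vs} u∉ len fg table =
    literals u >>= λ e (pos , neg) →
      mapGrow (λ ((fg' , _) , entries) → fg' , complete len fg' entries)
        (growEach (λ key C → Entry C (Q (u ∷ v ∷ vs) key) (chain u (v ∷ vs))) weakenEntry weakenStepAux
          (shannonEntry u∉) (transport weakenFalseGate e fg , transport weakenTable e table , pos , neg) keys)

  buildTables : ∀ {k} {C : Circ V k} u vs → Unique (u ∷ vs) → length (u ∷ vs) ≤ N → FalseGate C →
    Grow C (length vs * stepCost) (λ C' → FalseGate C' × Table C' u vs)
  buildTables u []       _              _   fg = baseTable u fg
  buildTables u (v ∷ vs) (u∉ ∷ unique) len fg =
    relax (ℕP.≤-reflexive (ℕP.+-comm (length vs * stepCost) stepCost))
      (buildTables v vs unique (ℕP.<⇒≤ len) fg >>= λ _ (fg' , table) → extendTable u∉ len fg' table)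

-- Shape of the middle disjuncts of F_n:  c ∧ ((e ∧ ¬a ∧ ¬b) ∨ (e ∧ a ∧ b)),
-- with c the range guard i < n and e the weight test.
Disjunct : Bool → Bool → Bool → Bool → Bool
Disjunct c e a b = c ∧ (((e ∧ not a) ∧ not b) ∨ ((e ∧ a) ∧ b))

disjunct-off : ∀ c e a b → (c ≡ true → e ≡ false) → Disjunct c e a b ≡ false
disjunct-off false e a b _ = refl
disjunct-off true  e a b h rewrite h refl = refl

disjunct-test : ∀ c e a b → Disjunct c e a b ≡ true → e ≡ true
disjunct-test true true a b _ = refl

disjunct-on : ∀ a b → Disjunct true true a b ≡ (if a then b else not b)
disjunct-on true  b = refl
disjunct-on false b = BoolP.∨-identityʳ (not b)


module HiddenWeightedBit (m : ℕ) where

  n : ℕ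
  n = suc m

  V : Set
  V = Var n

  _≟V_ : DecidableEquality V
  _≟V_ = SumP.≡-dec FinP._≟_ FinP._≟_

  open Update _≟V_
  open Tables _≟V_ n

  xs ys : List V
  xs = tabulate x
  ys = tabulate y

  xTree yTree : VTree V
  xTree = chain (x zero) (tabulate (x ∘ suc))
  yTree = chain (y zero) (tabulate (y ∘ suc))

  -- the variable x_{max(w,1)}, 0-based
  xIndex : Fin (suc n) → Fin n
  xIndex zero    = zero
  xIndex (suc j) = j

  weight≡count : ∀ ρ → weight n ρ ≡ count xs ρ
  weight≡count ρ = cong sum (trans (ListP.map-tabulate (λ j → j) (λ j → if ρ (x j) then 1 else 0))
                                   (sym (ListP.map-tabulate x (λ v → if ρ v then 1 else 0))))

  -- F_n with the weight replaced by W; by definition  F n ρ = F-at ρ (weight n ρ)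
  middle : (V → Bool) → ℕ → Fin n → Bool
  middle ρ W j = Disjunct (suc (toℕ j) <ᵇ n) (W ≡ᵇ suc (toℕ j)) (ρ (x j)) (ρ (y (suc j)))

  F-at : (V → Bool) → ℕ → Bool
  F-at ρ W = ((W ≡ᵇ 0) ∧ not (ρ (y zero))) ∨ (((W ≡ᵇ n) ∧ ρ (y (fromℕ n))) ∨ any (middle ρ W) (allFin n))

  F-zero : ∀ ρ → ρ (x zero) ≡ false → F-at ρ 0 ≡ literal (y zero) (ρ (x zero)) ρ
  F-zero ρ x₁ rewrite x₁ =
    trans (cong (not (ρ (y zero)) ∨_) (or-false _ (allFin n) (λ _ → BoolP.∧-zeroʳ _))) (BoolP.∨-identityʳ _)

  F-last : ∀ ρ → ρ (x (fromℕ m)) ≡ true → F-at ρ n ≡ literal (y (fromℕ n)) (ρ (x (fromℕ m))) ρ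
  F-last ρ xₙ rewrite xₙ | ≡ᵇ-refl m =
    trans (cong (ρ (y (fromℕ n)) ∨_) (or-false (middle ρ n) (allFin n) off)) (BoolP.∨-identityʳ _)
    where
    off : ∀ j → middle ρ n j ≡ false
    off j = disjunct-off _ _ _ _ λ lt →
      ≡ᵇ-false m (toℕ j) (λ e → ℕP.<-irrefl (sym e) (ℕP.<ᵇ⇒< (toℕ j) m (Equivalence.from BoolP.T-≡ lt)))

  F-middle : ∀ ρ j → toℕ j < m → F-at ρ (suc (toℕ j)) ≡ literal (y (suc j)) (ρ (x j)) ρ
  F-middle ρ j j<m rewrite ≡ᵇ-false (toℕ j) m (ℕP.<⇒≢ j<m) =
    trans (or-unique (middle ρ (suc (toℕ j))) (∈P.∈-allFin j) only)
          (trans (cong₂ (λ c e → Disjunct c e (ρ (x j)) (ρ (y (suc j)))) (Equivalence.to BoolP.T-≡ (ℕP.<⇒<ᵇ j<m)) (≡ᵇ-refl (toℕ j)))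
                 (disjunct-on (ρ (x j)) (ρ (y (suc j)))))
    where
    only : ∀ j' → middle ρ (suc (toℕ j)) j' ≡ true → j' ≡ j
    only j' h = FinP.toℕ-injective (sym (≡ᵇ-true (toℕ j) (toℕ j') (disjunct-test _ _ _ _ h)))

  F-literal : ∀ ρ (w : Fin (suc n)) → toℕ w ≡ weight n ρ → F n ρ ≡ literal (y w) (ρ (x (xIndex w))) ρ
  F-literal ρ w w≡ = trans (cong (F-at ρ) (sym w≡)) (by-position w (trans w≡ (weight≡count ρ)))
    where
    by-position : ∀ w → toℕ w ≡ count xs ρ → F-at ρ (toℕ w) ≡ literal (y w) (ρ (x (xIndex w))) ρ
    by-position zero    c = F-zero ρ (All.lookup (count-zero xs ρ (sym c)) (∈P.∈-tabulate⁺ {f = x} zero))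
    by-position (suc j) c with view j
    ... | ‵fromℕ = trans (cong (λ i → F-at ρ (suc i)) (FinP.toℕ-fromℕ m)) (F-last ρ (All.lookup all-true (∈P.∈-tabulate⁺ {f = x} (fromℕ m))))
      where
      all-true : All (λ v → ρ v ≡ true) xs
      all-true = count-full xs ρ (trans (sym c) (trans (cong suc (FinP.toℕ-fromℕ m)) (sym (ListP.length-tabulate x))))
    ... | ‵inject₁ i = F-middle ρ (inject₁ i) (subst (_< m) (sym (FinP.toℕ-inject₁ i)) (FinP.toℕ<n i))

  -- The root of the SDD.  A root key (w , b) stands for the prime
  -- [ weight = w ∧ x_{max(w,1)} = b ], a member of the counting family,
  -- and for the sub  y_w^b.
  RootKey : Set
  RootKey = Fin (suc n) × Bool

  rootKeys : List RootKey
  rootKeys = cartesianProduct (allFin (suc n)) bools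

  rootKeys-unique : Unique rootKeys
  rootKeys-unique = UniqueP.cartesianProduct⁺ (UniqueP.allFin⁺ (suc n)) bools-unique

  length-rootKeys : length rootKeys ≡ suc n * 2
  length-rootKeys = trans (length-cartesianProduct (allFin (suc n)) bools) (cong (_* 2) (ListP.length-tabulate {n = suc n} (λ j → j)))

  keyOf : RootKey → Key
  keyOf (w , b) = toℕ w , just (toℕ (xIndex w) , b)

  rootPrime rootSub : RootKey → BoolFn V
  rootPrime t       = Q xs (keyOf t)
  rootSub   (w , b) = literal (y w) b

  rootPrime-intro : ∀ {w b ρ} → toℕ w ≡ count xs ρ → ρ (x (xIndex w)) ≡ b → rootPrime (w , b) ρ ≡ true
  rootPrime-intro {w} {b} {ρ} w≡ xb = cong₂ _∧_
    (subst (λ c → (c ≡ᵇ toℕ w) ≡ true) w≡ (≡ᵇ-refl (toℕ w)))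
    (trans (mark-tabulate (x {n}) (xIndex w) b ρ) (literal-intro {v = x (xIndex w)} {b = b} {ρ = ρ} xb))

  rootPrime-unique : ∀ {t t' ρ} → rootPrime t ρ ≡ true → rootPrime t' ρ ≡ true → t ≡ t'
  rootPrime-unique {w , b} {w' , b'} {ρ} h h' = cong₂ _,_ w≡w' (trans (sym xb) (trans (cong (λ v → ρ (x (xIndex v))) w≡w') xb'))
    where
    weight-of : ∀ {w b} → rootPrime (w , b) ρ ≡ true → count xs ρ ≡ toℕ w
    weight-of h = ≡ᵇ-true _ _ (BoolP.∧-conicalˡ _ _ h)
    bit-of : ∀ {w b} → rootPrime (w , b) ρ ≡ true → ρ (x (xIndex w)) ≡ b
    bit-of {w} {b} h = literal-true {v = x (xIndex w)} {b = b} {ρ = ρ} (trans (sym (mark-tabulate (x {n}) (xIndex w) b ρ)) (BoolP.∧-conicalʳ _ _ h))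
    w≡w' : w ≡ w'
    w≡w' = FinP.toℕ-injective (trans (sym (weight-of h)) (weight-of h'))
    xb : ρ (x (xIndex w)) ≡ b
    xb = bit-of h
    xb' : ρ (x (xIndex w')) ≡ b'
    xb' = bit-of h'

  rootPrime-disjoint : ∀ {t t'} → t ≢ t' → ∀ ρ → (rootPrime t ρ ∧ rootPrime t' ρ) ≡ false
  rootPrime-disjoint {t} {t'} t≢t' ρ with rootPrime t ρ in h | rootPrime t' ρ in h'
  ... | false | _     = refl
  ... | true  | false = refl
  ... | true  | true  = ⊥-elim (t≢t' (rootPrime-unique h h'))

  -- distinct root keys have distinct subs: the same literal with opposite
  -- signs, or literals of different variables
  rootSub-distinct : ∀ {t t'} → t ≢ t' → ∃ λ ρ → rootSub t ρ ≢ rootSub t' ρ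
  rootSub-distinct {w , b} {w' , b'} t≢t' with w FinP.≟ w'
  ... | yes refl = (λ _ → true) , λ eq →
        t≢t' (cong (w ,_) (trans (sym (literal-const (y w) b)) (trans eq (literal-const (y w) b'))))
  ... | no w≢w'  = ρ , λ eq → false≢true (trans (sym sub'-false) (trans (sym eq) sub-true))
    where
    ρ : V → Bool
    ρ = (λ _ → not b') [ y w ≔ b ]
    sub-true : literal (y w) b ρ ≡ true
    sub-true = literal-intro {v = y w} {b = b} {ρ = ρ} (update-same (λ _ → not b') (y w) b)
    sub'-false : literal (y w') b' ρ ≡ false
    sub'-false = literal-flip {v = y w'} {b = b'} {ρ = ρ}
                   (update-other (λ _ → not b') (y w) b (y w') (w≢w' ∘ SumP.inj₂-injective))

  selected : (V → Bool) → RootKey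
  selected ρ = ŵ , ρ (x (xIndex ŵ))
    where
    ŵ : Fin (suc n)
    ŵ = fromℕ< (s≤s (subst (count xs ρ ≤_) (ListP.length-tabulate (x {n})) (count≤length xs ρ)))

  selected-weight : ∀ ρ → toℕ (proj₁ (selected ρ)) ≡ count xs ρ
  selected-weight ρ = FinP.toℕ-fromℕ< _

  selected-prime : ∀ ρ → rootPrime (selected ρ) ρ ≡ true
  selected-prime ρ = rootPrime-intro (selected-weight ρ) refl

  selected∈ : ∀ ρ → selected ρ ∈ rootKeys
  selected∈ ρ = ∈P.∈-cartesianProduct⁺ (∈P.∈-allFin _) (∈-bools _)

  module Root {k} {C : Circ V k} (table : Table C (x zero) (tabulate (x ∘ suc)))
              (subNodes : All (λ t → Node C (rootSub t) (leaf (y (proj₁ t)))) rootKeys) where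

    live? : Decidable (λ t → Sat (rootPrime t))
    live? t = satisfiable? (status (table (keyOf t)))

    live : List RootKey
    live = filter live? rootKeys

    rootElement : RootKey → Element
    rootElement t = element (rootPrime t) (rootSub t) xTree (leaf (y (proj₁ t)))

    elements : List Element
    elements = map rootElement live

    decomposition : Decomposition xTree yTree elements
    decomposition = record
      { primesLeft     = AllP.map⁺ (All.universal (λ _ → here) live)
      ; subsRight      = AllP.map⁺ (All.universal (λ t → leaf⊑chain (y zero) _ (∈P.∈-tabulate⁺ {f = y} (proj₁ t))) live)
      ; atLeastTwo     = subst (2 ≤_) (sym (ListP.length-map rootElement live))
                           (two-members (∈P.∈-filter⁺ live? (∈P.∈-cartesianProduct⁺ (∈P.∈-allFin zero) (∈-bools false)) none)
                                        (∈P.∈-filter⁺ live? (∈P.∈-cartesianProduct⁺ (∈P.∈-allFin _) (∈-bools true)) every)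
                                        (λ ()))
      ; primesSat      = AllP.map⁺ (AllP.all-filter live? rootKeys)
      ; primesDisjoint = AllPairsP.map⁺ (AllPairsP.filter⁺ live? (AllPairs.map rootPrime-disjoint rootKeys-unique))
      ; primesCover    = λ ρ → trans (cong BL.or (sym (ListP.map-∘ live)))
                           (or-member (λ t → rootPrime t ρ) (∈P.∈-filter⁺ live? (selected∈ ρ) (ρ , selected-prime ρ)) (selected-prime ρ))
      ; subsDistinct   = AllPairsP.map⁺ (AllPairsP.filter⁺ live? (AllPairs.map rootSub-distinct rootKeys-unique))
      }
      where
      none : Sat (rootPrime (zero , false))
      none = (λ _ → false) , rootPrime-intro {ρ = λ _ → false} (sym (count-none xs)) refl
      every : Sat (rootPrime (fromℕ n , true))
      every = (λ _ → true) , rootPrime-intro {ρ = λ _ → true} (trans (FinP.toℕ-fromℕ n) (sym (trans (count-all xs) (ListP.length-tabulate (x {n})))))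
                                             (refl {x = true})

    root-value : ∀ ρ → disjunction elements ρ ≡ F n ρ
    root-value ρ = begin
      disjunction elements ρ     ≡⟨ cong BL.or (sym (ListP.map-∘ live)) ⟩
      BL.or (map chosen live)     ≡⟨ or-filter live? chosen dead rootKeys ⟩
      BL.or (map chosen rootKeys) ≡⟨ or-unique chosen (selected∈ ρ) (λ t h → rootPrime-unique (BoolP.∧-conicalˡ _ _ h) (selected-prime ρ)) ⟩
      chosen (selected ρ)         ≡⟨ cong (_∧ rootSub (selected ρ) ρ) (selected-prime ρ) ⟩
      rootSub (selected ρ) ρ      ≡⟨ sym (F-literal ρ _ (trans (selected-weight ρ) (sym (weight≡count ρ)))) ⟩
      F n ρ                       ∎
      where
      open ≡-Reasoning
      chosen : RootKey → Bool
      chosen t = rootPrime t ρ ∧ rootSub t ρ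
      dead : ∀ t → ¬ Sat (rootPrime t) → chosen t ≡ false
      dead t unsat with rootPrime t ρ in h
      ... | true  = ⊥-elim (unsat (ρ , h))
      ... | false = refl

    root : Grow C (3 * (suc n * 2)) (Rooted (F n) (node xTree yTree))
    root = relax (ℕP.*-monoʳ-≤ 3 (subst (_≤ suc n * 2) (sym (ListP.length-map rootElement live))
                                    (subst (length live ≤_) length-rootKeys (ListP.length-filter live? rootKeys))))
             (mapGrow (retargetRooted root-value)
               (decide decomposition (AllP.map⁺ (AllP.filter⁺ live? (All.map (λ {t} s → entryNode (table (keyOf t)) , s) subNodes)))))

  xs-unique : Unique xs
  xs-unique = UniqueP.tabulate⁺ SumP.inj₁-injective

  vtree : IsVtreeFor V (node xTree yTree)
  vtree = subst (λ L → Unique L × (∀ v → v ∈ L))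
                (sym (cong₂ _++_ (leaves-chain (x zero) (tabulate (x ∘ suc))) (leaves-chain (y zero) (tabulate (y ∘ suc)))))
                (UniqueP.++⁺ xs-unique (UniqueP.tabulate⁺ SumP.inj₂-injective) disjoint , covers)
    where
    disjoint : ∀ {v} → ¬ (v ∈ xs × v ∈ ys)
    disjoint (v∈xs , v∈ys) with i , refl ← ∈P.∈-tabulate⁻ {f = x} v∈xs with () ← ∈P.∈-tabulate⁻ {f = y} v∈ys
    covers : ∀ v → v ∈ xs ++ ys
    covers (inj₁ j) = ∈P.∈-++⁺ˡ (∈P.∈-tabulate⁺ {f = x} j)
    covers (inj₂ j) = ∈P.∈-++⁺ʳ xs (∈P.∈-tabulate⁺ {f = y} j)

  construction : Grow ([] ▷ const false) (m * stepCost + 3 * (suc n * 2)) (Rooted (F n) (node xTree yTree))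
  construction =
    relax (ℕP.≤-reflexive (cong₂ (λ a b → a * stepCost + b)
                                  (ListP.length-tabulate {n = m} (λ j → x {n} (suc j)))
                                  (cong (_+ 3 * (suc n * 2)) (ℕP.*-zeroʳ (length rootKeys)))))
      (buildTables (x zero) (tabulate (x ∘ suc)) xs-unique (ℕP.≤-reflexive (ListP.length-tabulate (x {n})))
                   (mkFalse zero refl (λ _ → refl))
       >>= λ _ (_ , table) →
       growEach (λ t C → Node C (rootSub t) (leaf (y (proj₁ t)))) weakenNode weakenTable
                (λ _ (w , b) → appendGate (lit (y w) b) (literalNode _ (y w) b)) table rootKeys
       >>= λ _ (table' , subNodes) →
       Root.root table' subNodes)

  cubic : m * stepCost + 3 * (suc n * 2) ≤ 48 * n ^ 3
  cubic = begin
    m * stepCost + 3 * (suc n * 2)                                  ≡⟨ cong (λ l → m * (l * 6) + 3 * (suc n * 2)) length-keys ⟩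
    m * (suc n * suc (n * 2) * 6) + 3 * (suc n * 2)                 ≤⟨ ℕP.m≤m+n _ _ ⟩
    m * (suc n * suc (n * 2) * 6) + 3 * (suc n * 2) + slack          ≡⟨ identity m ⟩
    48 * n ^ 3                                                       ∎
    where
    open ℕP.≤-Reasoning
    slack : ℕ
    slack = 36 * m * m * m + 102 * m * m + 102 * m + 36
    identity : ∀ m → m * (suc (suc m) * suc (suc m * 2) * 6) + 3 * (suc (suc m) * 2) + (36 * m * m * m + 102 * m * m + 102 * m + 36)
                       ≡ 48 * (suc m * (suc m * (suc m * 1)))
    identity = solve-∀

  sdd : Σ ℕ λ k → Σ (Circ V (suc k)) λ C → IsSDDcFor C (F n) × size C ≤ 48 * n ^ 3
  sdd = within-bound (output vtree construction)
    where
    -- a separate function, so that construction is never unfolded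
    within-bound : (Σ ℕ λ k → Σ (Circ V (suc k)) λ C → IsSDDcFor C (F n) × size C ≤ m * stepCost + 3 * (suc n * 2)) →
                   Σ ℕ λ k → Σ (Circ V (suc k)) λ C → IsSDDcFor C (F n) × size C ≤ 48 * n ^ 3
    within-bound (k , C , isSDDc , bound) = k , C , isSDDc , ℕP.≤-trans bound cubic

lemma1 : ∃ λ (c : ℕ) → ∃ λ (N : ℕ) → ∀ (n : ℕ) → N ≤ n →
    Σ ℕ λ k → Σ (Circ (Var n) (suc k)) λ C → IsSDDcFor C (F n) × size C ≤ c * n ^ 3
lemma1 = 48 , 1 , λ { zero () ; (suc m) _ → HiddenWeightedBit.sdd m }
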